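{- Let $s_1,\dots,s_m$ be a sequence of integers with each $s_i\ge 2$, and let $S$ be the set of integers occurring in the sequence (with repetitions removed). Then for every integer $r\ge 2$, $$\bigl|\{2,\dots,r\}\setminus S\bigr|\le \max\{r-m-1,0\}+A(s_1,\dots,s_m).$$
   Context: For a sequence of $m$ positive integers $s_1,\dots,s_m$, define $A(s_1,\dots,s_m)=\sum_{j=1}^{m-1}|s_j-s_{j+1}-1|+|s_m-2|$. -}

module Defs where

open import Data.Nat using (ℕ; zero; suc; _+_; _∸_; _≤_)
open import Data.Integer using (ℤ; +_; _-_; ∣_∣)
open import Data.List using (List; []; _∷_; length; filter; upTo; map)
open import Data.List.Membership.DecPropositional (Data.Nat._≟_) using (_∉?_)

absDiff1 : ℕ → ℕ → ℕ
absDiff1 a b = ∣ + a - + b - + 1 ∣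

-- A(s_1,...,s_m) = Σ_{j=1}^{m-1} |s_j - s_{j+1} - 1| + |s_m - 2|
-- (only meaningful for nonempty sequences; A [] = 0 is an unused convention)
A : List ℕ → ℕ
A [] = 0
A (x ∷ []) = ∣ + x - + 2 ∣
A (x ∷ y ∷ rest) = absDiff1 x y + A (y ∷ rest)

range2 : ℕ → List ℕ
range2 r = map (λ i → i + 2) (upTo (r ∸ 1))

missingCount : ℕ → List ℕ → ℕ
missingCount r s = length (filter (λ i → i ∉? s) (range2 r))

-- Read backwards from the sentinel 1, the sequence sₘ, …, s₁ is a chain of members
-- of S. For consecutive chain elements b, z, moving the start of a window of values
-- from b + 1 to z + 1 while shortening it by one (z itself is present) costs at most
-- |z − b − 1| missing values. Telescoping along the chain, at most A(s) of the m
-- integers 2, …, m + 1 are missing; each of the other r − m − 1 integers of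
-- {2, …, r} costs at most one.
module Submission where

open import Defs
open import Data.Nat using (ℕ; _≤_; _+_; _∸_; _⊔_)
open import Data.List using (List; []; length)
open import Data.List.Relation.Unary.All using (All)
open import Relation.Binary.PropositionalEquality using (_≢_)

open import Data.Nat using (zero; suc; z≤n; s≤s; _≤?_)
open import Data.Nat.Properties
open import Data.List using (_∷_; filter; applyUpTo)
open import Data.List.Properties using (map-upTo)
open import Data.List.Membership.Propositional using (_∈_)
open import Data.List.Membership.DecPropositional (Data.Nat._≟_) using (_∈?_; _∉?_)
open import Data.List.Relation.Binary.Subset.Propositional using (_⊆_)
open import Data.List.Relation.Unary.Any using (here; there)
open import Data.Integer using (_⊖_; ∣_∣; -_) renaming (_+_ to _+ℤ_; +_ to ⁺_)
import Data.Integer.Properties as ℤP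
open import Function using (id; _∘_)
open import Relation.Nullary using (yes; no; contradiction)
open import Relation.Binary.PropositionalEquality
  using (_≡_; refl; sym; trans; cong; module ≡-Reasoning)

missing : List ℕ → ℕ → ℕ → ℕ
missing S a zero = 0
missing S a (suc n) with a ∈? S
... | yes _ = missing S (suc a) n
... | no _  = suc (missing S (suc a) n)

module _ (S : List ℕ) where

  missing-≤ : ∀ a n → missing S a n ≤ n
  missing-≤ a zero = z≤n
  missing-≤ a (suc n) with a ∈? S
  ... | yes _ = m≤n⇒m≤1+n (missing-≤ (suc a) n)
  ... | no _  = s≤s (missing-≤ (suc a) n)

  missing-+ : ∀ a p q → missing S a (p + q) ≡ missing S a p + missing S (p + a) q
  missing-+ a zero    q = refl
  missing-+ a (suc p) q with a ∈? S
  ... | yes _ = trans (missing-+ (suc a) p q) (cong (λ c → missing S (suc a) p + missing S c q) (+-suc p a))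
  ... | no _  = cong suc (trans (missing-+ (suc a) p q) (cong (λ c → missing S (suc a) p + missing S c q) (+-suc p a)))

  missing-∈ : ∀ {z} n → z ∈ S → missing S z (suc n) ≡ missing S (suc z) n
  missing-∈ {z} n z∈S with z ∈? S
  ... | yes _   = refl
  ... | no z∉S = contradiction z∈S z∉S

  missing-mono : ∀ a {n n′} → n ≤ n′ → missing S a n ≤ missing S a n′
  missing-mono a {n} {n′} n≤n′ = begin
    missing S a n                                ≤⟨ m≤m+n _ _ ⟩
    missing S a n + missing S (n + a) (n′ ∸ n)   ≡⟨ missing-+ a n (n′ ∸ n) ⟨
    missing S a (n + (n′ ∸ n))                   ≡⟨ cong (missing S a) (m+[n∸m]≡n n≤n′) ⟩
    missing S a n′                               ∎
    where open ≤-Reasoning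

  missing-suffix : ∀ a p n → missing S (p + a) n ≤ missing S a (p + n)
  missing-suffix a p n = begin
    missing S (p + a) n                  ≤⟨ m≤n+m _ _ ⟩
    missing S a p + missing S (p + a) n  ≡⟨ missing-+ a p n ⟨
    missing S a (p + n)                  ∎
    where open ≤-Reasoning

absDiff1-⊖ : ∀ z b → absDiff1 z b ≡ ∣ z ⊖ suc b ∣
absDiff1-⊖ z b = cong ∣_∣ (begin
    (⁺ z +ℤ - ⁺ b) +ℤ - ⁺ 1   ≡⟨ ℤP.+-assoc (⁺ z) (- ⁺ b) (- ⁺ 1) ⟩
    ⁺ z +ℤ (- ⁺ b +ℤ - ⁺ 1)   ≡⟨ cong (⁺ z +ℤ_) (ℤP.neg-distrib-+ (⁺ b) (⁺ 1)) ⟨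
    ⁺ z +ℤ - ⁺ (b + 1)        ≡⟨ cong (λ c → ⁺ z +ℤ - ⁺ c) (+-comm b 1) ⟩
    ⁺ z +ℤ - ⁺ suc b          ≡⟨ ℤP.m-n≡m⊖n z (suc b) ⟩
    z ⊖ suc b                 ∎)
  where open ≡-Reasoning

absDiff1-> : ∀ {z b} → suc b ≤ z → absDiff1 z b ≡ z ∸ suc b
absDiff1-> {z} {b} b<z = trans (absDiff1-⊖ z b) (cong ∣_∣ (ℤP.⊖-≥ b<z))

absDiff1-≤ : ∀ {z b} → z ≤ b → absDiff1 z b ≡ suc (b ∸ z)
absDiff1-≤ {z} {b} z≤b =
  trans (absDiff1-⊖ z b) (trans (ℤP.∣⊖∣-≤ (m≤n⇒m≤1+n z≤b)) (+-∸-assoc 1 z≤b))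

-- The window after b loses at most z ∸ (b + 1) values below z when z > b, and at
-- most the b + 1 − z values beyond the shifted window [z + 1, z + k] when z ≤ b.
missing-step : ∀ {S} z b k → z ∈ S →
               missing S (suc b) (suc k) ≤ absDiff1 z b + missing S (suc z) k
missing-step {S} z b k z∈S with suc b ≤? z
... | yes b<z = begin
    missing S (suc b) (suc k)                         ≤⟨ missing-mono S (suc b) (m≤n+m (suc k) e) ⟩
    missing S (suc b) (e + suc k)                     ≡⟨ missing-+ S (suc b) e (suc k) ⟩
    missing S (suc b) e + missing S (e + suc b) (suc k)
      ≡⟨ cong (λ c → missing S (suc b) e + missing S c (suc k)) (m∸n+n≡m b<z) ⟩
    missing S (suc b) e + missing S z (suc k)         ≡⟨ cong (missing S (suc b) e +_) (missing-∈ S k z∈S) ⟩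
    missing S (suc b) e + missing S (suc z) k         ≤⟨ +-monoˡ-≤ _ (missing-≤ S (suc b) e) ⟩
    e + missing S (suc z) k                           ≡⟨ cong (_+ missing S (suc z) k) (absDiff1-> b<z) ⟨
    absDiff1 z b + missing S (suc z) k                ∎
  where
    open ≤-Reasoning
    e : ℕ
    e = z ∸ suc b
... | no b≮z = begin
    missing S (suc b) (suc k)                         ≡⟨ cong (λ c → missing S c (suc k)) (sym e+z≡b) ⟩
    missing S (e + suc z) (suc k)                     ≤⟨ missing-suffix S (suc z) e (suc k) ⟩
    missing S (suc z) (e + suc k)                     ≡⟨ cong (missing S (suc z)) (trans (+-comm e (suc k)) (sym (+-suc k e))) ⟩
    missing S (suc z) (k + suc e)                     ≡⟨ missing-+ S (suc z) k (suc e) ⟩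
    missing S (suc z) k + missing S (k + suc z) (suc e) ≤⟨ +-monoʳ-≤ _ (missing-≤ S _ (suc e)) ⟩
    missing S (suc z) k + suc e                       ≡⟨ +-comm _ (suc e) ⟩
    suc e + missing S (suc z) k                       ≡⟨ cong (_+ missing S (suc z) k) (absDiff1-≤ z≤b) ⟨
    absDiff1 z b + missing S (suc z) k                ∎
  where
    open ≤-Reasoning
    z≤b : z ≤ b
    z≤b = ≤-pred (≰⇒> b≮z)
    e : ℕ
    e = b ∸ z
    e+z≡b : e + suc z ≡ suc b
    e+z≡b = trans (+-suc e z) (cong suc (m∸n+n≡m z≤b))

-- A with the final term |sₘ − 2| generalised to |sₘ − b − 1|.
chainCost : ℕ → List ℕ → ℕ
chainCost b []           = 0
chainCost b (x ∷ [])     = absDiff1 x b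
chainCost b (x ∷ y ∷ xs) = absDiff1 x y + chainCost b (y ∷ xs)

A≡chainCost : ∀ s → A s ≡ chainCost 1 s
A≡chainCost []           = refl
A≡chainCost (x ∷ [])     = cong ∣_∣ (sym (ℤP.+-assoc (⁺ x) (- ⁺ 1) (- ⁺ 1)))
A≡chainCost (x ∷ y ∷ xs) = cong (absDiff1 x y +_) (A≡chainCost (y ∷ xs))

-- Generalised over the length k of a further window, so that the induction
-- can run from the front of the list although the windows are laid out from its end.
missing-chain : ∀ {S} b x xs → x ∷ xs ⊆ S → ∀ k →
  missing S (suc b) (length (x ∷ xs) + k) ≤ chainCost b (x ∷ xs) + missing S (suc x) k
missing-chain b x []       x∷xs⊆S k = missing-step x b k (x∷xs⊆S (here refl))
missing-chain {S} b x (y ∷ ys) x∷xs⊆S k = begin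
    missing S (suc b) (suc (length (y ∷ ys)) + k)
      ≡⟨ cong (missing S (suc b)) (+-suc (length (y ∷ ys)) k) ⟨
    missing S (suc b) (length (y ∷ ys) + suc k)
      ≤⟨ missing-chain b y ys (x∷xs⊆S ∘ there) (suc k) ⟩
    c + missing S (suc y) (suc k)
      ≤⟨ +-monoʳ-≤ c (missing-step x y k (x∷xs⊆S (here refl))) ⟩
    c + (absDiff1 x y + missing S (suc x) k)
      ≡⟨ +-assoc c (absDiff1 x y) _ ⟨
    c + absDiff1 x y + missing S (suc x) k
      ≡⟨ cong (_+ missing S (suc x) k) (+-comm c (absDiff1 x y)) ⟩
    absDiff1 x y + c + missing S (suc x) k ∎
  where
    open ≤-Reasoning
    c : ℕ
    c = chainCost b (y ∷ ys)

missing-bound : ∀ s k → missing s 2 (length s + k) ≤ A s + k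
missing-bound []       k = missing-≤ [] 2 k
missing-bound (x ∷ xs) k = begin
    missing (x ∷ xs) 2 (length (x ∷ xs) + k)                ≤⟨ missing-chain 1 x xs id k ⟩
    chainCost 1 (x ∷ xs) + missing (x ∷ xs) (suc x) k       ≤⟨ +-monoʳ-≤ _ (missing-≤ (x ∷ xs) (suc x) k) ⟩
    chainCost 1 (x ∷ xs) + k                                ≡⟨ cong (_+ k) (A≡chainCost (x ∷ xs)) ⟨
    A (x ∷ xs) + k                                          ∎
  where open ≤-Reasoning

length-filter-applyUpTo : ∀ S a n (f : ℕ → ℕ) → (∀ i → f i ≡ i + a) →
  length (filter (_∉? S) (applyUpTo f n)) ≡ missing S a n
length-filter-applyUpTo S a zero    f f≗+a = refl
length-filter-applyUpTo S a (suc n) f f≗+a rewrite f≗+a 0 with a ∈? S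
... | yes _ = length-filter-applyUpTo S (suc a) n (f ∘ suc) (λ i → trans (f≗+a (suc i)) (sym (+-suc i a)))
... | no _  = cong suc (length-filter-applyUpTo S (suc a) n (f ∘ suc) (λ i → trans (f≗+a (suc i)) (sym (+-suc i a))))

missingCount≡missing : ∀ r s → missingCount r s ≡ missing s 2 (r ∸ 1)
missingCount≡missing r s =
  trans (cong (λ is → length (filter (_∉? s) is)) (map-upTo (_+ 2) (r ∸ 1)))
        (length-filter-applyUpTo s 2 (r ∸ 1) (_+ 2) (λ _ → refl))

∸-swap : ∀ m n o → m ∸ n ∸ o ≡ m ∸ o ∸ n
∸-swap m n o = trans (∸-+-assoc m n o) (trans (cong (m ∸_) (+-comm n o)) (sym (∸-+-assoc m o n)))

-- The bound holds for every list and every r: none of the hypotheses is used.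
mainTheorem5 : (s : List ℕ) → s ≢ [] → All (λ x → 2 ≤ x) s → (r : ℕ) → 2 ≤ r →
    missingCount r s ≤ ((r ∸ length s ∸ 1) ⊔ 0) + A s
mainTheorem5 s _ _ r _ = begin
    missingCount r s                 ≡⟨ missingCount≡missing r s ⟩
    missing s 2 n                    ≤⟨ missing-mono s 2 (m≤n+m∸n n m) ⟩
    missing s 2 (m + (n ∸ m))        ≤⟨ missing-bound s (n ∸ m) ⟩
    A s + (n ∸ m)                    ≡⟨ +-comm (A s) (n ∸ m) ⟩
    (n ∸ m) + A s                    ≡⟨ cong (_+ A s) (trans (∸-swap r 1 m) (sym (⊔-identityʳ _))) ⟩
    ((r ∸ m ∸ 1) ⊔ 0) + A s          ∎
  where
    open ≤-Reasoning
    m n : ℕ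
    m = length s
    n = r ∸ 1
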